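{- For every type $A$ of $\mathrm{CP}+\mathrm{Mix}_0+\mathrm{Mix}_2$, every $a\in[\![A]\!]$ and every $b\in[\![A^{L\bot}]\!]$: $(a,b)\in[\![T^{A}_{x,y}\vdash x:A^\bot,y:A^{L\bot}]\!]$ if and only if $F_A(a)=b$.
   Context: CP processes, typing and denotations $[\![P\vdash\Gamma]\!]$ as follows. Types $A::=\mathbf{1}\mid\bot\mid A\otimes B\mid A⅋B\mid A\oplus B\mid A\&B\mid !A\mid ?A$, usual linear duality $(-)^\bot$. Processes/typing: $x\leftrightarrow y\vdash x:A,y:A^\bot$; $x[]\vdash x:\mathbf{1}$; $x().P\vdash\Gamma,x:\bot$ from $P\vdash\Gamma$; $\overline{x}[y].(P\mid Q)\vdash\Gamma,\Delta,x:A\otimes B$ from $P\vdash\Gamma,y:A$, $Q\vdash\Delta,x:B$ (send fresh $y$ along $x$); $x(y).P\vdash\Gamma,x:A⅋B$ from $P\vdash\Gamma,y:A,x:B$; $x.i;P\vdash\Gamma,x:A_1\oplus A_2$ from $P\vdash\Gamma,x:A_i$; $x.\mathrm{case}(P,Q)\vdash\Gamma,x:A_1\&A_2$ from $P\vdash\Gamma,x:A_1$, $Q\vdash\Gamma,x:A_2$; $!x(y).P\vdash ?\Delta,x:!A$ from $P\vdash ?\Delta,y:A$; $?x[y].P\vdash\Delta,x:?A$ from $P\vdash\Delta,y:A$; contraction, weakening on $?$-types; cut $(\nu x)(P\mid Q)$; $0\vdash\cdot$; $P\mid Q\vdash\Gamma,\Delta$ from $P\vdash\Gamma$, $Q\vdash\Delta$.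 Observation sets: $[\![\mathbf{1}]\!]=[\![\bot]\!]=\{*\}$, $[\![A\otimes B]\!]=[\![A⅋B]\!]=[\![A]\!]\times[\![B]\!]$, $[\![A_1\oplus A_2]\!]=[\![A_1\&A_2]\!]=\{(i,a)\mid a\in[\![A_i]\!]\}$, $[\![!A]\!]=[\![?A]\!]$ = finite multisets over $[\![A]\!]$ (so $[\![A^\bot]\!]=[\![A]\!]$). Denotations: forwarder $\{(a,a)\}$; $x[]$: $\{(*)\}$; $0$: $\{()\}$; $x().P$: $\{(\gamma,*)\mid\gamma\in[\![P]\!]\}$; cut: $\{(\gamma,\delta)\mid\exists a.(\gamma,a)\in[\![P]\!],(\delta,a)\in[\![Q]\!]\}$; output: $\{(\gamma,\delta,(a,b))\mid(\gamma,a)\in[\![P]\!],(\delta,b)\in[\![Q]\!]\}$; input: $\{(\gamma,(a,b))\mid(\gamma,a,b)\in[\![P]\!]\}$; selection: $\{(\gamma,(i,a))\mid(\gamma,a)\in[\![P]\!]\}$; branching: $\bigcup_i\{(\gamma,(i,a))\mid(\gamma,a)\in[\![P_i]\!]\}$; server (context $x_1:?B_1,\dots,x_n:?B_n$): $\{(\biguplus_{j=1}^k\alpha^1_j,\dots,\biguplus_{j=1}^k\alpha^n_j,\langle a_1,\dots,a_k\rangle)\mid k\ge0,\forall j.(\alpha^1_j,\dots,\alpha^n_j,a_j)\in[\![P]\!]\}$; client: $\{(\gamma,\langle a\rangle)\mid(\gamma,a)\in[\![P]\!]\}$; weakening: $\{(\gamma,\emptyset)\}$; contraction: $\{(\gamma,\alpha_1\uplus\alpha_2)\mid(\gamma,\alpha_1,\alpha_2)\in[\![P]\!]\}$;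 mix: product. Translation on types: $\bot^{L\bot}=\bot$; $\mathbf{1}^{L\bot}=\mathbf{1}\otimes\bot$; $(A\otimes B)^{L\bot}=((A^{L\bot}⅋\mathbf{1})\otimes(B^{L\bot}⅋\mathbf{1}))\otimes\bot$; $(A⅋B)^{L\bot}=A^{L\bot}⅋B^{L\bot}$; $(A\oplus B)^{L\bot}=((A^{L\bot}⅋\mathbf{1})\oplus(B^{L\bot}⅋\mathbf{1}))\otimes\bot$; $(A\&B)^{L\bot}=A^{L\bot}\&B^{L\bot}$; $(!A)^{L\bot}=!(A^{L\bot}⅋\mathbf{1})\otimes\bot$; $(?A)^{L\bot}=?((A^{L\bot}⅋\mathbf{1})\otimes\bot)$. Maps $F_A:[\![A]\!]\to[\![A^{L\bot}]\!]$: $F_\bot(*)=*$; $F_{\mathbf{1}}(*)=(*,*)$; $F_{A⅋B}(a,b)=(F_A(a),F_B(b))$; $F_{A\otimes B}(a,b)=(((F_A(a),*),(F_B(b),*)),*)$; $F_{A_1\&A_2}(i,a)=(i,F_{A_i}(a))$; $F_{A_1\oplus A_2}(i,a)=((i,(F_{A_i}(a),*)),*)$; $F_{!A}(\langle a_1,\dots,a_k\rangle)=(\langle(F_A(a_1),*),\dots,(F_A(a_k),*)\rangle,*)$; $F_{?A}(\langle a_1,\dots,a_k\rangle)=\langle((F_A(a_1),*),*),\dots,((F_A(a_k),*),*)\rangle$. Transformer processes $T^A_{x,x'}\vdash x:A^\bot,x':A^{L\bot}$, by recursion on $A$: $T^\bot_{x,x'}=x\leftrightarrow x'$; $T^{\mathbf{1}}_{x,x'}=\overline{x'}[y].(y\leftrightarrow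 x\mid x'().0)$; $T^{A\otimes B}_{x,z}=x(y).\overline{z}[z_2].\big(\overline{z_2}[z_1].(z_1(y').(T^A_{y,y'}\mid z_1[])\mid z_2(x').(T^B_{x,x'}\mid z_2[]))\mid z().0\big)$; $T^{A⅋B}_{x,x'}=x'(y').\overline{x}[y].(T^A_{y,y'}\mid T^B_{x,x'})$; $T^{!A}_{x,x'}=\overline{x'}[w'].\big(!w'(w).?x[y].w(y').(T^A_{y,y'}\mid w[])\mid x'().0\big)$; $T^{?A}_{x,x'}=!x(y).?x'[m].\overline{m}[z].\big(z(y').(T^A_{y,y'}\mid z[])\mid m().0\big)$; $T^{A_1\&A_2}_{x,x'}=x'.\mathrm{case}(x.1;T^{A_1}_{x,x'},\;x.2;T^{A_2}_{x,x'})$; $T^{A_1\oplus A_2}_{x,x'}=x.\mathrm{case}(P_1,P_2)$ with $P_i=\overline{x'}[w].\big(w.i;w(y').(T^{A_i}_{x,y'}\mid w[])\mid x'().0\big)$. -}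

module Defs where

open import Data.Unit using (⊤; tt)
open import Data.Empty renaming (⊥ to Empty)
open import Data.Product using (Σ; ∃; _×_; _,_; proj₁; proj₂)
open import Data.Sum using (_⊎_; inj₁; inj₂)
open import Data.List using (List; []; _∷_; _++_; map; concat)
open import Data.List.Relation.Unary.All using (All)
open import Data.List.Relation.Binary.Permutation.Propositional
  using (_↭_; refl; prep; swap; trans)
open import Data.List.Relation.Binary.Permutation.Homogeneous using (Permutation)
open import Relation.Binary.PropositionalEquality using (_≡_)

infixr 8 _⊗_ _⅋_
infixr 7 _⊕_ _&_
infix  9 !_ ¿_

data Ty : Set where
  one bot   : Ty
  _⊗_ _⅋_   : Ty → Ty → Ty
  _⊕_ _&_   : Ty → Ty → Ty
  !_ ¿_     : Ty → Ty

dual : Ty → Ty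
dual one     = bot
dual bot     = one
dual (A ⊗ B) = dual A ⅋ dual B
dual (A ⅋ B) = dual A ⊗ dual B
dual (A ⊕ B) = dual A & dual B
dual (A & B) = dual A ⊕ dual B
dual (! A)   = ¿ dual A
dual (¿ A)   = ! dual A

-- the translation A ↦ A^{L⊥}
L : Ty → Ty
L bot     = bot
L one     = one ⊗ bot
L (A ⊗ B) = ((L A ⅋ one) ⊗ (L B ⅋ one)) ⊗ bot
L (A ⅋ B) = L A ⅋ L B
L (A ⊕ B) = ((L A ⅋ one) ⊕ (L B ⅋ one)) ⊗ bot
L (A & B) = L A & L B
L (! A)   = (! (L A ⅋ one)) ⊗ bot
L (¿ A)   = ¿ ((L A ⅋ one) ⊗ bot)

-- Observation sets [[A]].  Finite multisets are represented by lists,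
-- and equality of observations (Eq A) identifies lists up to
-- permutation (recursively), i.e. equality of finite multisets.

Obs : Ty → Set
Obs one     = ⊤
Obs bot     = ⊤
Obs (A ⊗ B) = Obs A × Obs B
Obs (A ⅋ B) = Obs A × Obs B
Obs (A ⊕ B) = Obs A ⊎ Obs B
Obs (A & B) = Obs A ⊎ Obs B
Obs (! A)   = List (Obs A)
Obs (¿ A)   = List (Obs A)

Eq : (A : Ty) → Obs A → Obs A → Set
Eq one _ _ = ⊤
Eq bot _ _ = ⊤
Eq (A ⊗ B) (a , b) (a' , b') = Eq A a a' × Eq B b b'
Eq (A ⅋ B) (a , b) (a' , b') = Eq A a a' × Eq B b b'
Eq (A ⊕ B) (inj₁ a) (inj₁ a') = Eq A a a'
Eq (A ⊕ B) (inj₂ b) (inj₂ b') = Eq B b b'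
Eq (A ⊕ B) _ _ = Empty
Eq (A & B) (inj₁ a) (inj₁ a') = Eq A a a'
Eq (A & B) (inj₂ b) (inj₂ b') = Eq B b b'
Eq (A & B) _ _ = Empty
Eq (! A) xs ys = Permutation (Eq A) xs ys
Eq (¿ A) xs ys = Permutation (Eq A) xs ys

-- the identification [[A]] = [[A^⊥]]
toDual : (A : Ty) → Obs A → Obs (dual A)
toDual one     a        = a
toDual bot     a        = a
toDual (A ⊗ B) (a , b)  = toDual A a , toDual B b
toDual (A ⅋ B) (a , b)  = toDual A a , toDual B b
toDual (A ⊕ B) (inj₁ a) = inj₁ (toDual A a)
toDual (A ⊕ B) (inj₂ b) = inj₂ (toDual B b)
toDual (A & B) (inj₁ a) = inj₁ (toDual A a)
toDual (A & B) (inj₂ b) = inj₂ (toDual B b)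
toDual (! A)   xs       = map (toDual A) xs
toDual (¿ A)   xs       = map (toDual A) xs

F : (A : Ty) → Obs A → Obs (L A)
F bot     _        = tt
F one     _        = tt , tt
F (A ⅋ B) (a , b)  = F A a , F B b
F (A ⊗ B) (a , b)  = ((F A a , tt) , (F B b , tt)) , tt
F (A & B) (inj₁ a) = inj₁ (F A a)
F (A & B) (inj₂ b) = inj₂ (F B b)
F (A ⊕ B) (inj₁ a) = inj₁ (F A a , tt) , tt
F (A ⊕ B) (inj₂ b) = inj₂ (F B b , tt) , tt
F (! A)   xs       = map (λ a → F A a , tt) xs , tt
F (¿ A)   xs       = map (λ a → (F A a , tt) , tt) xs

Ctx : Set
Ctx = List Ty

Env : Ctx → Set
Env []      = ⊤
Env (A ∷ Γ) = Obs A × Env Γ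

EqEnv : (Γ : Ctx) → Env Γ → Env Γ → Set
EqEnv []      _        _          = ⊤
EqEnv (A ∷ Γ) (a , γ) (a' , γ')   = Eq A a a' × EqEnv Γ γ γ'

split : (Γ : Ctx) {Δ : Ctx} → Env (Γ ++ Δ) → Env Γ × Env Δ
split []      δ       = tt , δ
split (A ∷ Γ) (a , γ) = let r = split Γ γ in (a , proj₁ r) , proj₂ r

permEnv : {Γ Δ : Ctx} → Γ ↭ Δ → Env Γ → Env Δ
permEnv refl           γ           = γ
permEnv (prep x p)     (a , γ)     = a , permEnv p γ
permEnv (swap x y p)   (a , b , γ) = b , a , permEnv p γ
permEnv (trans p q)    γ           = permEnv q (permEnv p γ)

whyNots : Ctx → Ctx
whyNots = map ¿_

⨄ : (Δ : Ctx) → List (Env (whyNots Δ)) → Env (whyNots Δ)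
⨄ []      es = tt
⨄ (B ∷ Δ) es = concat (map proj₁ es) , ⨄ Δ (map proj₂ es)

-- Intrinsically typed CP + Mix0 + Mix2 processes.  Channels are the
-- positions of the context; the principal channel of each rule is the
-- head of the context; exchange is an explicit rule.

data Proc : Ctx → Set where
  fwd      : ∀ {A} → Proc (A ∷ dual A ∷ [])
  close    : Proc (one ∷ [])
  wait     : ∀ {Γ} → Proc Γ → Proc (bot ∷ Γ)
  send     : ∀ {A B Γ Δ} → Proc (A ∷ Γ) → Proc (B ∷ Δ) → Proc (A ⊗ B ∷ Γ ++ Δ)
  recv     : ∀ {A B Γ} → Proc (A ∷ B ∷ Γ) → Proc (A ⅋ B ∷ Γ)
  sel₁     : ∀ {A B Γ} → Proc (A ∷ Γ) → Proc (A ⊕ B ∷ Γ)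
  sel₂     : ∀ {A B Γ} → Proc (B ∷ Γ) → Proc (A ⊕ B ∷ Γ)
  branch   : ∀ {A B Γ} → Proc (A ∷ Γ) → Proc (B ∷ Γ) → Proc (A & B ∷ Γ)
  server   : ∀ {A Δ} → Proc (A ∷ whyNots Δ) → Proc (! A ∷ whyNots Δ)
  client   : ∀ {A Γ} → Proc (A ∷ Γ) → Proc (¿ A ∷ Γ)
  weaken   : ∀ {A Γ} → Proc Γ → Proc (¿ A ∷ Γ)
  contract : ∀ {A Γ} → Proc (¿ A ∷ ¿ A ∷ Γ) → Proc (¿ A ∷ Γ)
  cut      : ∀ {A Γ Δ} → Proc (A ∷ Γ) → Proc (dual A ∷ Δ) → Proc (Γ ++ Δ)
  halt     : Proc []
  mix      : ∀ {Γ Δ} → Proc Γ → Proc Δ → Proc (Γ ++ Δ)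
  exch     : ∀ {Γ Δ} → Γ ↭ Δ → Proc Γ → Proc Δ

⟦_⟧ : ∀ {Γ} → Proc Γ → Env Γ → Set
⟦ fwd {A} ⟧ (a , b , _) = Eq (dual A) (toDual A a) b
⟦ close ⟧ _ = ⊤
⟦ wait P ⟧ (_ , γ) = ⟦ P ⟧ γ
⟦ send {Γ = Γ} P Q ⟧ ((a , b) , γδ) =
  ⟦ P ⟧ (a , proj₁ (split Γ γδ)) × ⟦ Q ⟧ (b , proj₂ (split Γ γδ))
⟦ recv P ⟧ ((a , b) , γ) = ⟦ P ⟧ (a , b , γ)
⟦ sel₁ P ⟧ (inj₁ a , γ) = ⟦ P ⟧ (a , γ)
⟦ sel₁ P ⟧ (inj₂ _ , γ) = Empty
⟦ sel₂ P ⟧ (inj₁ _ , γ) = Empty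
⟦ sel₂ P ⟧ (inj₂ b , γ) = ⟦ P ⟧ (b , γ)
⟦ branch P Q ⟧ (inj₁ a , γ) = ⟦ P ⟧ (a , γ)
⟦ branch P Q ⟧ (inj₂ b , γ) = ⟦ Q ⟧ (b , γ)
⟦ server {A} {Δ} P ⟧ (ms , αs) =
  Σ (List (Obs A × Env (whyNots Δ))) λ ts →
    All (λ t → ⟦ P ⟧ (proj₁ t , proj₂ t)) ts
    × Eq (! A) ms (map proj₁ ts)
    × EqEnv (whyNots Δ) αs (⨄ Δ (map proj₂ ts))
⟦ client {A} P ⟧ (m , γ) = Σ (Obs A) λ a → ⟦ P ⟧ (a , γ) × Eq (¿ A) m (a ∷ [])
⟦ weaken {A} P ⟧ (m , γ) = Eq (¿ A) m [] × ⟦ P ⟧ γ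
⟦ contract {A} P ⟧ (m , γ) =
  Σ (Obs (¿ A)) λ α₁ → Σ (Obs (¿ A)) λ α₂ → ⟦ P ⟧ (α₁ , α₂ , γ) × Eq (¿ A) m (α₁ ++ α₂)
⟦ cut {A} {Γ} P Q ⟧ γδ =
  Σ (Obs A) λ a → ⟦ P ⟧ (a , proj₁ (split Γ γδ)) × ⟦ Q ⟧ (toDual A a , proj₂ (split Γ γδ))
⟦ halt ⟧ _ = ⊤
⟦ mix {Γ} P Q ⟧ γδ = ⟦ P ⟧ (proj₁ (split Γ γδ)) × ⟦ Q ⟧ (proj₂ (split Γ γδ))
⟦ exch {Γ} p P ⟧ δ = Σ (Env Γ) λ γ → ⟦ P ⟧ γ × permEnv p γ ≡ δ

rot : ∀ {a b c : Ty} → (a ∷ b ∷ c ∷ []) ↭ (b ∷ c ∷ a ∷ [])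
rot {a} {b} {c} = trans (swap a b refl) (prep b (swap a c refl))

sw : ∀ {a b : Ty} → (a ∷ b ∷ []) ↭ (b ∷ a ∷ [])
sw {a} {b} = swap a b refl

mutual
  T : (A : Ty) → Proc (dual A ∷ L A ∷ [])
  T bot     = fwd {one}
  T one     = exch sw (send (fwd {one}) (wait halt))
  T (A ⊗ B) = recv (exch rot
                (send (send (TA1 A) (TA1 B)) (wait halt)))
  T (A ⅋ B) = exch sw (recv (exch rot (send (T A) (T B))))
  T (A & B) = exch sw (branch (exch sw (sel₁ (T A))) (exch sw (sel₂ (T B))))
  T (A ⊕ B) = branch (exch sw (send (sel₁ (TA1 A)) (wait halt)))
                     (exch sw (send (sel₂ (TA1 B)) (wait halt)))
  T (! A)   = exch sw (send (server {Δ = dual A ∷ []}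
                               (exch sw (client (exch sw (TA1 A)))))
                            (wait halt))
  T (¿ A)   = server {Δ = (L A ⅋ one) ⊗ bot ∷ []}
                (exch sw (client (send (TA1 A) (wait halt))))

  TA1 : (A : Ty) → Proc (L A ⅋ one ∷ dual A ∷ [])
  TA1 A = recv (exch rot (mix (T A) close))

{-# OPTIONS --safe #-}
module Submission where

-- By induction on A, ⟦ T A ⟧ relates an arbitrary x ∈ [[A^⊥]] to b exactly
-- when b = F A (fromDual A x) up to Eq.  Quantifying over all of [[A^⊥]],
-- not just the image of toDual, is what makes the exponential cases go
-- through: a server's copies receive arbitrary observations of A^⊥.
-- Multiplicative and additive cases: T consists of exchanges, ⅋1 / ⊗⊥
-- padding (which only adds trivial ⊤ components) and the induction
-- hypotheses.  Exponential cases: T is a server whose body answers each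
-- request with exactly one client call.  Such a server denotes the multiset
-- lifting of the body's relation, and lifting the graph of an Eq-respecting
-- function f gives the graph of map f.

open import Defs
open import Data.Unit using (tt)
open import Data.Product using (∃; _×_; _,_; proj₁; proj₂)
open import Data.Product.Function.NonDependent.Propositional using (_×-⇔_)
open import Data.Sum using (inj₁; inj₂)
open import Data.List using (List; []; _∷_; map; concat)
open import Data.List.Properties using (map-id; map-∘)
open import Data.List.Relation.Unary.All using (All; []; _∷_)
open import Data.List.Relation.Binary.Pointwise as Pointwise using (Pointwise; []; _∷_)
import Data.List.Relation.Binary.Permutation.Homogeneous as Permutation
import Data.List.Relation.Binary.Permutation.Setoid as PermutationSetoid
import Data.List.Relation.Binary.Permutation.Setoid.Properties as PermutationProperties
open import Function.Base using (id; flip)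
open import Function.Bundles using (_⇔_; mk⇔; Equivalence)
import Function.Properties.Equivalence as ⇔
open import Function.Related.Propositional using (equivalence; module EquationalReasoning)
open import Level using (0ℓ)
open import Relation.Binary.Bundles using (Setoid)
open import Relation.Binary.PropositionalEquality using (_≡_; refl; cong; cong₂; subst)

Eq-refl : (A : Ty) {a : Obs A} → Eq A a a
Eq-refl one = tt
Eq-refl bot = tt
Eq-refl (A ⊗ B) = Eq-refl A , Eq-refl B
Eq-refl (A ⅋ B) = Eq-refl A , Eq-refl B
Eq-refl (A ⊕ B) {inj₁ _} = Eq-refl A
Eq-refl (A ⊕ B) {inj₂ _} = Eq-refl B
Eq-refl (A & B) {inj₁ _} = Eq-refl A
Eq-refl (A & B) {inj₂ _} = Eq-refl B
Eq-refl (! A) = Permutation.refl (Pointwise.refl (Eq-refl A))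
Eq-refl (¿ A) = Permutation.refl (Pointwise.refl (Eq-refl A))

Eq-sym : (A : Ty) {a b : Obs A} → Eq A a b → Eq A b a
Eq-sym one _ = tt
Eq-sym bot _ = tt
Eq-sym (A ⊗ B) (p , q) = Eq-sym A p , Eq-sym B q
Eq-sym (A ⅋ B) (p , q) = Eq-sym A p , Eq-sym B q
Eq-sym (A ⊕ B) {inj₁ _} {inj₁ _} p = Eq-sym A p
Eq-sym (A ⊕ B) {inj₂ _} {inj₂ _} p = Eq-sym B p
Eq-sym (A & B) {inj₁ _} {inj₁ _} p = Eq-sym A p
Eq-sym (A & B) {inj₂ _} {inj₂ _} p = Eq-sym B p
Eq-sym (! A) = Permutation.sym (Eq-sym A)
Eq-sym (¿ A) = Permutation.sym (Eq-sym A)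

Eq-trans : (A : Ty) {a b c : Obs A} → Eq A a b → Eq A b c → Eq A a c
Eq-trans one _ _ = tt
Eq-trans bot _ _ = tt
Eq-trans (A ⊗ B) (p , q) (p′ , q′) = Eq-trans A p p′ , Eq-trans B q q′
Eq-trans (A ⅋ B) (p , q) (p′ , q′) = Eq-trans A p p′ , Eq-trans B q q′
Eq-trans (A ⊕ B) {inj₁ _} {inj₁ _} {inj₁ _} p q = Eq-trans A p q
Eq-trans (A ⊕ B) {inj₂ _} {inj₂ _} {inj₂ _} p q = Eq-trans B p q
Eq-trans (A & B) {inj₁ _} {inj₁ _} {inj₁ _} p q = Eq-trans A p q
Eq-trans (A & B) {inj₂ _} {inj₂ _} {inj₂ _} p q = Eq-trans B p q
Eq-trans (! A) = Permutation.trans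
Eq-trans (¿ A) = Permutation.trans

Obs-setoid : Ty → Setoid 0ℓ 0ℓ
Obs-setoid A = record
  { Carrier       = Obs A
  ; _≈_           = Eq A
  ; isEquivalence = record { refl = Eq-refl A ; sym = Eq-sym A ; trans = Eq-trans A }
  }

module _ {A : Ty} where
  open PermutationSetoid (Obs-setoid A) public using (↭-refl; ↭-sym; ↭-trans)
  open PermutationProperties (Obs-setoid A) public using (++⁺; map⁺)

fromDual : (A : Ty) → Obs (dual A) → Obs A
fromDual one     a        = a
fromDual bot     a        = a
fromDual (A ⊗ B) (a , b)  = fromDual A a , fromDual B b
fromDual (A ⅋ B) (a , b)  = fromDual A a , fromDual B b
fromDual (A ⊕ B) (inj₁ a) = inj₁ (fromDual A a)
fromDual (A ⊕ B) (inj₂ b) = inj₂ (fromDual B b)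
fromDual (A & B) (inj₁ a) = inj₁ (fromDual A a)
fromDual (A & B) (inj₂ b) = inj₂ (fromDual B b)
fromDual (! A)   xs       = map (fromDual A) xs
fromDual (¿ A)   xs       = map (fromDual A) xs

mutual
  fromDual-toDual : (A : Ty) (a : Obs A) → fromDual A (toDual A a) ≡ a
  fromDual-toDual one     _        = refl
  fromDual-toDual bot     _        = refl
  fromDual-toDual (A ⊗ B) (a , b)  = cong₂ _,_ (fromDual-toDual A a) (fromDual-toDual B b)
  fromDual-toDual (A ⅋ B) (a , b)  = cong₂ _,_ (fromDual-toDual A a) (fromDual-toDual B b)
  fromDual-toDual (A ⊕ B) (inj₁ a) = cong inj₁ (fromDual-toDual A a)
  fromDual-toDual (A ⊕ B) (inj₂ b) = cong inj₂ (fromDual-toDual B b)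
  fromDual-toDual (A & B) (inj₁ a) = cong inj₁ (fromDual-toDual A a)
  fromDual-toDual (A & B) (inj₂ b) = cong inj₂ (fromDual-toDual B b)
  fromDual-toDual (! A)   xs       = map-fromDual-toDual A xs
  fromDual-toDual (¿ A)   xs       = map-fromDual-toDual A xs

  map-fromDual-toDual : (A : Ty) (xs : List (Obs A)) → map (fromDual A) (map (toDual A) xs) ≡ xs
  map-fromDual-toDual A []       = refl
  map-fromDual-toDual A (x ∷ xs) = cong₂ _∷_ (fromDual-toDual A x) (map-fromDual-toDual A xs)

fromDual-resp : (A : Ty) {x y : Obs (dual A)} → Eq (dual A) x y → Eq A (fromDual A x) (fromDual A y)
fromDual-resp one     _ = tt
fromDual-resp bot     _ = tt
fromDual-resp (A ⊗ B) (p , q) = fromDual-resp A p , fromDual-resp B q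
fromDual-resp (A ⅋ B) (p , q) = fromDual-resp A p , fromDual-resp B q
fromDual-resp (A ⊕ B) {inj₁ _} {inj₁ _} p = fromDual-resp A p
fromDual-resp (A ⊕ B) {inj₂ _} {inj₂ _} p = fromDual-resp B p
fromDual-resp (A & B) {inj₁ _} {inj₁ _} p = fromDual-resp A p
fromDual-resp (A & B) {inj₂ _} {inj₂ _} p = fromDual-resp B p
fromDual-resp (! A) = map⁺ (Obs-setoid A) (fromDual-resp A)
fromDual-resp (¿ A) = map⁺ (Obs-setoid A) (fromDual-resp A)

F-resp : (A : Ty) {x y : Obs A} → Eq A x y → Eq (L A) (F A x) (F A y)
F-resp one     _ = tt , tt
F-resp bot     _ = tt
F-resp (A ⊗ B) (p , q) = ((F-resp A p , tt) , (F-resp B q , tt)) , tt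
F-resp (A ⅋ B) (p , q) = F-resp A p , F-resp B q
F-resp (A ⊕ B) {inj₁ _} {inj₁ _} p = (F-resp A p , tt) , tt
F-resp (A ⊕ B) {inj₂ _} {inj₂ _} p = (F-resp B p , tt) , tt
F-resp (A & B) {inj₁ _} {inj₁ _} p = F-resp A p
F-resp (A & B) {inj₂ _} {inj₂ _} p = F-resp B p
F-resp (! A) p = map⁺ (Obs-setoid (L A ⅋ one)) (λ q → F-resp A q , tt) p , tt
F-resp (¿ A) p = map⁺ (Obs-setoid ((L A ⅋ one) ⊗ bot)) (λ q → (F-resp A q , tt) , tt) p

exch-sw : ∀ {A B} (P : Proc (A ∷ B ∷ [])) {a b} →
  ⟦ exch sw P ⟧ (a , b , tt) ⇔ ⟦ P ⟧ (b , a , tt)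
exch-sw P = mk⇔ (λ { (_ , p , refl) → p }) (λ p → _ , p , refl)

exch-rot : ∀ {A B C} (P : Proc (A ∷ B ∷ C ∷ [])) {a b c} →
  ⟦ exch rot P ⟧ (a , b , c , tt) ⇔ ⟦ P ⟧ (c , a , b , tt)
exch-rot P = mk⇔ (λ { (_ , p , refl) → p }) (λ p → _ , p , refl)

data Lift↭ (A B : Ty) (R : Obs A → Obs B → Set) (as : List (Obs A)) (bs : List (Obs B)) : Set where
  lift↭ : ∀ {as′ bs′} →
    Eq (! A) as as′ → Pointwise R as′ bs′ → Eq (! B) bs bs′ → Lift↭ A B R as bs

Lift↭-cong : ∀ {A B} {R S : Obs A → Obs B → Set} → (∀ a b → R a b ⇔ S a b) →
  ∀ {as bs} → Lift↭ A B R as bs ⇔ Lift↭ A B S as bs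
Lift↭-cong R⇔S = mk⇔
  (λ { (lift↭ p rs q) → lift↭ p (Pointwise.map (Equivalence.to (R⇔S _ _)) rs) q })
  (λ { (lift↭ p ss q) → lift↭ p (Pointwise.map (Equivalence.from (R⇔S _ _)) ss) q })

Lift↭-flip : ∀ {A B} {R : Obs A → Obs B → Set} {as bs} →
  Lift↭ A B R as bs ⇔ Lift↭ B A (flip R) bs as
Lift↭-flip = mk⇔
  (λ { (lift↭ p rs q) → lift↭ q (Pointwise.symmetric id rs) p })
  (λ { (lift↭ q rs p) → lift↭ p (Pointwise.symmetric id rs) q })

Lift↭-graphʳ : ∀ {A B} (h : Obs A → Obs B) → (∀ {x y} → Eq A x y → Eq B (h x) (h y)) →
  ∀ {as bs} → Lift↭ A B (λ a b → Eq B (h a) b) as bs ⇔ Eq (! B) (map h as) bs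
Lift↭-graphʳ {A} {B} h h-resp {as} {bs} = mk⇔
  (λ { (lift↭ {as′} {bs′} p hs q) → begin
     map h as   ↭⟨ map⁺ (Obs-setoid B) h-resp p ⟩
     map h as′  ≋⟨ Pointwise.map⁺ h id hs ⟩
     map id bs′ ≡⟨ map-id bs′ ⟩
     bs′        ↭⟨ q ⟨
     bs         ∎ })
  (λ p → lift↭ ↭-refl (graph as) (↭-sym p))
  where
  open PermutationSetoid.PermutationReasoning (Obs-setoid B)
  graph : ∀ as → Pointwise (λ a b → Eq B (h a) b) as (map h as)
  graph []       = []
  graph (_ ∷ as) = Eq-refl B ∷ graph as

Lift↭-graphˡ : ∀ {A B} (g : Obs B → Obs A) → (∀ {x y} → Eq B x y → Eq A (g x) (g y)) →
  ∀ {as bs} → Lift↭ A B (λ a b → Eq A (g b) a) as bs ⇔ Eq (! A) (map g bs) as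
Lift↭-graphˡ g g-resp = ⇔.trans Lift↭-flip (Lift↭-graphʳ g g-resp)

module _ {A B : Ty} (Q : Proc (B ∷ A ∷ [])) where

  copies⇒pointwise : ∀ {ts : List (Obs A × Env (whyNots (B ∷ [])))} →
    All (λ t → ⟦ exch sw (client Q) ⟧ (proj₁ t , proj₂ t)) ts →
    ∃ λ bs′ → Pointwise (λ a b → ⟦ Q ⟧ (b , a , tt)) (map proj₁ ts) bs′
              × Eq (! B) (concat (map proj₁ (map proj₂ ts))) bs′
  copies⇒pointwise [] = [] , [] , ↭-refl
  copies⇒pointwise (p ∷ ps) with Equivalence.to (exch-sw (client Q)) p | copies⇒pointwise ps
  ... | b , q , α↭b | bs′ , qs , αs↭bs′ = b ∷ bs′ , q ∷ qs , ++⁺ α↭b αs↭bs′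

  pointwise⇒copies : ∀ {as′ bs′} → Pointwise (λ a b → ⟦ Q ⟧ (b , a , tt)) as′ bs′ →
    ∃ λ (ts : List (Obs A × Env (whyNots (B ∷ [])))) →
      All (λ t → ⟦ exch sw (client Q) ⟧ (proj₁ t , proj₂ t)) ts
      × map proj₁ ts ≡ as′ × concat (map proj₁ (map proj₂ ts)) ≡ bs′
  pointwise⇒copies [] = [] , [] , refl , refl
  pointwise⇒copies {a ∷ _} {b ∷ _} (q ∷ qs) with pointwise⇒copies qs
  ... | ts , ps , refl , refl =
    (a , (b ∷ []) , tt) ∷ ts ,
    Equivalence.from (exch-sw (client Q)) (b , q , ↭-refl) ∷ ps ,
    refl , refl

  server-client : ∀ {as bs} →
    ⟦ server {Δ = B ∷ []} (exch sw (client Q)) ⟧ (as , bs , tt)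
    ⇔ Lift↭ A B (λ a b → ⟦ Q ⟧ (b , a , tt)) as bs
  server-client = mk⇔
    (λ (ts , ps , as↭ , bs↭ , _) → let bs′ , qs , αs↭bs′ = copies⇒pointwise ps in
       lift↭ as↭ qs (↭-trans bs↭ αs↭bs′))
    from-lift
    where
    from-lift : ∀ {as bs} → Lift↭ A B (λ a b → ⟦ Q ⟧ (b , a , tt)) as bs →
      ⟦ server {Δ = B ∷ []} (exch sw (client Q)) ⟧ (as , bs , tt)
    from-lift (lift↭ as↭ qs bs↭) with pointwise⇒copies qs
    ... | ts , ps , refl , refl = ts , ps , as↭ , bs↭ , tt

T-Graph : Ty → Set
T-Graph A = ∀ x b → ⟦ T A ⟧ (x , b , tt) ⇔ Eq (L A) (F A (fromDual A x)) b

TA1-graph : ∀ {A} → T-Graph A →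
  ∀ x lu → ⟦ TA1 A ⟧ (lu , x , tt) ⇔ Eq (L A ⅋ one) (F A (fromDual A x) , tt) lu
TA1-graph {A} graph-A x lu =
  ⇔.trans (exch-rot (mix (T A) close)) (graph-A x (proj₁ lu) ×-⇔ ⇔.refl)

T-graph-⊗ : ∀ {A B} → T-Graph A → T-Graph B → T-Graph (A ⊗ B)
T-graph-⊗ {A} {B} graph-A graph-B (x₁ , x₂) ((lu₁ , lu₂) , _) =
  ⇔.trans (exch-rot (send (send (TA1 A) (TA1 B)) (wait halt)))
          ((TA1-graph graph-A x₁ lu₁ ×-⇔ TA1-graph graph-B x₂ lu₂) ×-⇔ ⇔.refl)

T-graph-⅋ : ∀ {A B} → T-Graph A → T-Graph B → T-Graph (A ⅋ B)
T-graph-⅋ {A} {B} graph-A graph-B (x₁ , x₂) (l₁ , l₂) =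
  ⇔.trans (exch-sw (recv (exch rot (send (T A) (T B)))))
          (⇔.trans (exch-rot (send (T A) (T B))) (graph-A x₁ l₁ ×-⇔ graph-B x₂ l₂))

T-graph-& : ∀ {A B} → T-Graph A → T-Graph B → T-Graph (A & B)
T-graph-& {A} {B} graph-A graph-B x b =
  ⇔.trans (exch-sw (branch (exch sw (sel₁ (T A))) (exch sw (sel₂ (T B))))) (branches x b)
  where
  branches : ∀ x b → ⟦ branch (exch sw (sel₁ (T A))) (exch sw (sel₂ (T B))) ⟧ (b , x , tt)
                     ⇔ Eq (L (A & B)) (F (A & B) (fromDual (A & B) x)) b
  branches (inj₁ y) (inj₁ l) = ⇔.trans (exch-sw (sel₁ (T A))) (graph-A y l)
  branches (inj₂ _) (inj₁ _) = exch-sw (sel₁ (T A))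
  branches (inj₁ _) (inj₂ _) = exch-sw (sel₂ (T B))
  branches (inj₂ y) (inj₂ l) = ⇔.trans (exch-sw (sel₂ (T B))) (graph-B y l)

T-graph-⊕ : ∀ {A B} → T-Graph A → T-Graph B → T-Graph (A ⊕ B)
T-graph-⊕ {A} {B} graph-A _ (inj₁ y) (inj₁ lu , _) =
  ⇔.trans (exch-sw (send (sel₁ (TA1 A)) (wait halt))) (TA1-graph graph-A y lu ×-⇔ ⇔.refl)
T-graph-⊕ {A} {B} _ _ (inj₁ _) (inj₂ _ , _) = exch-sw (send (sel₁ (TA1 A)) (wait halt))
T-graph-⊕ {A} {B} _ _ (inj₂ _) (inj₁ _ , _) = exch-sw (send (sel₂ (TA1 B)) (wait halt))
T-graph-⊕ {A} {B} _ graph-B (inj₂ y) (inj₂ lu , _) =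
  ⇔.trans (exch-sw (send (sel₂ (TA1 B)) (wait halt))) (TA1-graph graph-B y lu ×-⇔ ⇔.refl)

T-graph-! : ∀ {A} → T-Graph A → T-Graph (! A)
T-graph-! {A} graph-A zs (ms , _) = ⇔.trans (exch-sw (send S (wait halt))) (serve ×-⇔ ⇔.refl)
  where
  Q : Proc (dual A ∷ L A ⅋ one ∷ [])
  Q = exch sw (TA1 A)
  S : Proc (! (L A ⅋ one) ∷ ¿ dual A ∷ [])
  S = server {Δ = dual A ∷ []} (exch sw (client Q))
  g : Obs (dual A) → Obs (L A ⅋ one)
  g z = F A (fromDual A z) , tt
  g-resp : ∀ {x y} → Eq (dual A) x y → Eq (L A ⅋ one) (g x) (g y)
  g-resp p = F-resp A (fromDual-resp A p) , tt
  open EquationalReasoning {k = equivalence}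
  serve : ⟦ S ⟧ (ms , zs , tt)
          ⇔ Eq (! (L A ⅋ one)) (map (λ a → F A a , tt) (map (fromDual A) zs)) ms
  serve = begin
    ⟦ S ⟧ (ms , zs , tt)
      ∼⟨ server-client Q ⟩
    Lift↭ (L A ⅋ one) (dual A) (λ m z → ⟦ Q ⟧ (z , m , tt)) ms zs
      ∼⟨ Lift↭-cong (λ m z → ⇔.trans (exch-sw (TA1 A)) (TA1-graph graph-A z m)) ⟩
    Lift↭ (L A ⅋ one) (dual A) (λ m z → Eq (L A ⅋ one) (g z) m) ms zs
      ∼⟨ Lift↭-graphˡ g g-resp ⟩
    Eq (! (L A ⅋ one)) (map g zs) ms
      ≡⟨ cong (λ ys → Eq (! (L A ⅋ one)) ys ms) (map-∘ zs) ⟩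
    Eq (! (L A ⅋ one)) (map (λ a → F A a , tt) (map (fromDual A) zs)) ms ∎

T-graph-¿ : ∀ {A} → T-Graph A → T-Graph (¿ A)
T-graph-¿ {A} graph-A zs bs = begin
    ⟦ server {Δ = X ∷ []} (exch sw (client Q)) ⟧ (zs , bs , tt)
      ∼⟨ server-client Q ⟩
    Lift↭ (dual A) X (λ z c → ⟦ Q ⟧ (c , z , tt)) zs bs
      ∼⟨ Lift↭-cong (λ z c → TA1-graph graph-A z (proj₁ c) ×-⇔ ⇔.refl) ⟩
    Lift↭ (dual A) X (λ z c → Eq X (h z) c) zs bs
      ∼⟨ Lift↭-graphʳ h h-resp ⟩
    Eq (¿ X) (map h zs) bs
      ≡⟨ cong (λ ys → Eq (¿ X) ys bs) (map-∘ zs) ⟩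
    Eq (¿ X) (map (λ a → (F A a , tt) , tt) (map (fromDual A) zs)) bs ∎
  where
  X : Ty
  X = (L A ⅋ one) ⊗ bot
  Q : Proc (X ∷ dual A ∷ [])
  Q = send (TA1 A) (wait halt)
  h : Obs (dual A) → Obs X
  h z = (F A (fromDual A z) , tt) , tt
  h-resp : ∀ {x y} → Eq (dual A) x y → Eq X (h x) (h y)
  h-resp p = (F-resp A (fromDual-resp A p) , tt) , tt
  open EquationalReasoning {k = equivalence}

T-graph : ∀ A → T-Graph A
T-graph bot     _ _ = ⇔.refl
T-graph one     _ _ = exch-sw (send (fwd {one}) (wait halt))
T-graph (A ⊗ B) = T-graph-⊗ (T-graph A) (T-graph B)
T-graph (A ⅋ B) = T-graph-⅋ (T-graph A) (T-graph B)
T-graph (A & B) = T-graph-& (T-graph A) (T-graph B)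
T-graph (A ⊕ B) = T-graph-⊕ (T-graph A) (T-graph B)
T-graph (! A)   = T-graph-! (T-graph A)
T-graph (¿ A)   = T-graph-¿ (T-graph A)

lemma31 : (A : Ty) (a : Obs A) (b : Obs (L A)) →
    (⟦ T A ⟧ (toDual A a , b , tt) → Eq (L A) (F A a) b)
    × (Eq (L A) (F A a) b → ⟦ T A ⟧ (toDual A a , b , tt))
lemma31 A a b = Equivalence.to graph , Equivalence.from graph
  where
  graph : ⟦ T A ⟧ (toDual A a , b , tt) ⇔ Eq (L A) (F A a) b
  graph = subst (λ a′ → ⟦ T A ⟧ (toDual A a , b , tt) ⇔ Eq (L A) (F A a′) b)
                (fromDual-toDual A a) (T-graph A (toDual A a) b)
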